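{- For all positive integers $a,b,c$, the pattern $[b\,a\,c\,a\,b\,a\,c]$ is forbidden; that is, no path in any skip graph has seven consecutive edges that are arcs of sizes $b,a,c,a,b,a,c$ in this order.
   Context: For a finite set $S$ of positive integers, the skip graph $G(S)$ has vertex set $\mathbb{N}=\{0,1,2,\dots\}$ and, for each $s\in S$ and $j\ge0$, an edge (an $s$-arc) between $2js$ and $(2j+1)s$. An unsigned pattern $[a_1\dots a_n]$ is realizable if there exist signs $\epsilon_k\in\{\pm1\}$ and an integer $T\ge0$ such that with $T_0=T$, $T_k=T_{k-1}+\epsilon_ka_k$, each $T_{k-1}$ is an even multiple of $a_k$ (0 included) when $\epsilon_k=+1$ and an odd multiple of $a_k$ when $\epsilon_k=-1$, and $T_0,\dots,T_n$ are pairwise distinct; equivalently some path with distinct vertices in some skip graph has consecutive edges that are arcs of sizes $a_1,\dots,a_n$. A pattern that is not realizable is forbidden. -}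

module Defs where

open import Data.Nat using (ℕ; zero; suc; _+_; _*_)
open import Data.List using (List; []; _∷_)
open import Data.Product using (Σ; ∃; _×_; _,_)
open import Data.Sum using (_⊎_)
open import Data.List.Relation.Unary.Unique.Propositional using (Unique)
open import Relation.Binary.PropositionalEquality using (_≡_)
open import Relation.Nullary using (¬_)

-- One signed step of size a from T to T':
--   ε = +1 : T is an even multiple of a (0 included) and T' = T + a
--   ε = -1 : T is an odd multiple of a and T' = T - a  (written T' + a = T)
Step : ℕ → ℕ → ℕ → Set
Step a T T' =
  (∃ λ j → T ≡ (2 * j) * a × T' ≡ T + a)
  ⊎ (∃ λ j → T ≡ (2 * j + 1) * a × T' + a ≡ T)

data Follows : List ℕ → List ℕ → Set where
  done : ∀ T → Follows [] (T ∷ [])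
  step : ∀ {a as T T' Ts} → Step a T T' → Follows as (T' ∷ Ts)
         → Follows (a ∷ as) (T ∷ T' ∷ Ts)

Realizable : List ℕ → Set
Realizable pat = Σ (List ℕ) λ Ts → Follows pat Ts × Unique Ts

Forbidden : List ℕ → Set
Forbidden pat = ¬ Realizable pat

-- Each of T₁,…,T₆ ends an a-arc, so they are multiples of a, and hence so are b and c;
-- dividing by a reduces to a = 1 and the middle segment [1 c 1 b 1] with b ∣ T₁, c ∣ T₆.
-- If T₁ and T₆ are both odd, then b and c are odd, so each of the five steps flips parity,
-- which is absurd. Otherwise, reversing the path if necessary, T₁ is even; the walk is
-- then forced to go up 1, down c, up 1, down b, up 1 with b, c odd, which gives
-- T₁ + 2 = T₄ + c and T₃ + 2 = T₆ + b. Since b ∣ T₁, T₄ and c ∣ T₃, T₆, and b, c ≥ 3 by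
-- distinctness, the first equation forces b < c and the second c < b.
module Submission where

open import Data.Nat
open import Data.Nat.Properties
open import Data.Nat.Divisibility using (_∣_; divides; ∣m+n∣m⇒∣n; ∣⇒≤; n∣m*n; *-cancelʳ-∣)
open import Data.Parity.Base as ℙ using (0ℙ; 1ℙ; _⁻¹)
import Data.Parity.Properties as ℙ
open import Data.List using ([]; _∷_)
open import Data.List.Relation.Unary.All using (_∷_)
open import Data.List.Relation.Unary.AllPairs using (_∷_)
open import Data.Product using (_×_; _,_; proj₁; proj₂)
open import Function using (_∘_)
open import Data.Sum using (inj₁; inj₂)
open import Data.Empty using (⊥)
open import Relation.Binary.PropositionalEquality
open import Defs

private
  variable
    a b c d s x y z w : ℕ
    β γ t₁ t₂ t₃ t₄ t₅ t₆ T₁ T₂ T₃ T₄ T₅ T₆ : ℕ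

parity-even-multiple : ∀ j s → parity (2 * j * s) ≡ 0ℙ
parity-even-multiple j s = trans (ℙ.*-homo-* (2 * j) s) (cong (ℙ._* parity s) (ℙ.*-homo-* 2 j))

parity-odd-multiple : ∀ j s → parity ((2 * j + 1) * s) ≡ parity s
parity-odd-multiple j s = trans (ℙ.*-homo-* (2 * j + 1) s)
  (cong (ℙ._* parity s) (trans (ℙ.+-homo-+ (2 * j) 1) (cong (ℙ._+ 1ℙ) (ℙ.*-homo-* 2 j))))

parity-+-odd : parity s ≡ 1ℙ → ∀ x → parity (x + s) ≡ parity x ⁻¹
parity-+-odd {s} odd x = trans (ℙ.+-homo-+ x s)
  (trans (cong (parity x ℙ.+_) odd) (ℙ.+-comm (parity x) 1ℙ))

odd-divisor : d ∣ x → parity x ≡ 1ℙ → parity d ≡ 1ℙ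
odd-divisor {d} (divides q refl) odd = right-factor (parity q) (trans (sym (ℙ.*-homo-* q d)) odd)
  where
  right-factor : ∀ p {r} → p ℙ.* r ≡ 1ℙ → r ≡ 1ℙ
  right-factor 1ℙ e = e

odd≢1⇒3≤ : parity x ≡ 1ℙ → x ≢ 1 → 3 ≤ x
odd≢1⇒3≤ {1} _ x≢1 with () ← x≢1 refl
odd≢1⇒3≤ {suc (suc (suc _))} _ _ = s≤s (s≤s (s≤s z≤n))

multiple-gap⇒< : d ∣ x → d ∣ y → x + 2 ≡ y + s → 3 ≤ s → d < s
multiple-gap⇒< {d} {x} {y} d∣x d∣y eq (s≤s (s≤s (s≤s {n = k} _))) =
  s≤s (m≤n⇒m≤1+n (∣⇒≤ (∣m+n∣m⇒∣n (subst (d ∣_) x≡y+1+k d∣x) d∣y)))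
  where
  x≡y+1+k : x ≡ y + suc k
  x≡y+1+k = +-cancelʳ-≡ 2 x (y + suc k)
    (trans eq (sym (trans (+-assoc y (suc k) 2) (cong (y +_) (+-comm (suc k) 2)))))

odd-multiple-≡ : ∀ j s → (2 * j + 1) * s ≡ 2 * j * s + s
odd-multiple-≡ j s = trans (*-distribʳ-+ s (2 * j) 1) (cong (2 * j * s +_) (+-identityʳ s))

Step-sym : Step s x y → Step s y x
Step-sym {s} {x} (inj₁ (j , refl , refl)) = inj₂ (j , sym (odd-multiple-≡ j s) , refl)
Step-sym {s} {y = y} (inj₂ (j , refl , y+s≡x)) =
  inj₁ (j , +-cancelʳ-≡ s y (2 * j * s) (trans y+s≡x (odd-multiple-≡ j s)) , sym y+s≡x)

Step-∣ˡ : Step s x y → s ∣ x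
Step-∣ˡ (inj₁ (j , x≡ , _)) = divides (2 * j) x≡
Step-∣ˡ (inj₂ (j , x≡ , _)) = divides (2 * j + 1) x≡

Step-∣ʳ : Step s x y → s ∣ y
Step-∣ʳ = Step-∣ˡ ∘ Step-sym

Step-size-∣ : d ∣ x → d ∣ y → Step s x y → d ∣ s
Step-size-∣ {d} d∣x d∣y (inj₁ (_ , _ , y≡x+s)) = ∣m+n∣m⇒∣n (subst (d ∣_) y≡x+s d∣y) d∣x
Step-size-∣ {d} d∣x d∣y (inj₂ (_ , _ , y+s≡x)) = ∣m+n∣m⇒∣n (subst (d ∣_) (sym y+s≡x) d∣x) d∣y

Step-cancel : .{{_ : NonZero a}} → Step (s * a) (x * a) (y * a) → Step s x y
Step-cancel {a} {s} {x} {y} (inj₁ (j , ex , ey)) = inj₁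
  ( j , *-cancelʳ-≡ x (2 * j * s) a (trans ex (sym (*-assoc (2 * j) s a)))
  , *-cancelʳ-≡ y (x + s) a (trans ey (sym (*-distribʳ-+ a x s))) )
Step-cancel {a} {s} {x} {y} (inj₂ (j , ex , ey)) = inj₂
  ( j , *-cancelʳ-≡ x ((2 * j + 1) * s) a (trans ex (sym (*-assoc (2 * j + 1) s a)))
  , *-cancelʳ-≡ (y + s) x a (trans (*-distribʳ-+ a y s) ey) )

Step-cancel-unit : .{{_ : NonZero a}} → Step a (x * a) (y * a) → Step 1 x y
Step-cancel-unit {a} {x} {y} st =
  Step-cancel (subst (λ s → Step s (x * a) (y * a)) (sym (*-identityˡ a)) st)

Step-up : parity s ≡ 1ℙ → parity x ≡ 0ℙ → Step s x y → y ≡ x + s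
Step-up _ _ (inj₁ (_ , _ , y≡x+s)) = y≡x+s
Step-up {s} odd even (inj₂ (j , refl , _))
  with () ← trans (sym even) (trans (parity-odd-multiple j s) odd)

Step-down : parity x ≡ 1ℙ → Step s x y → parity s ≡ 1ℙ × y + s ≡ x
Step-down {s = s} odd (inj₁ (j , refl , _))
  with () ← trans (sym odd) (parity-even-multiple j s)
Step-down {s = s} odd (inj₂ (j , refl , y+s≡x)) =
  trans (sym (parity-odd-multiple j s)) odd , y+s≡x

Step-flips-parity : parity s ≡ 1ℙ → Step s x y → ∀ {p} → parity x ≡ p → parity y ≡ p ⁻¹
Step-flips-parity {x = x} odd st {0ℙ} even =
  trans (cong parity (Step-up odd even st)) (trans (parity-+-odd odd x) (cong _⁻¹ even))
Step-flips-parity {s} {x} {y} _ st {1ℙ} odd with Step-down odd st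
... | odd-s , y+s≡x = sym (ℙ.⁻¹-selfInverse
  (trans (sym (parity-+-odd odd-s y)) (trans (cong parity y+s≡x) odd)))

up-down-up-gap : y ≡ x + 1 → z + s ≡ y → w ≡ z + 1 → x + 2 ≡ w + s
up-down-up-gap {x = x} {z} {s} refl z+s≡x+1 refl = begin
  x + 2         ≡⟨ +-assoc x 1 1 ⟨
  x + 1 + 1     ≡⟨ cong (_+ 1) z+s≡x+1 ⟨
  z + s + 1     ≡⟨ +-assoc z s 1 ⟩
  z + (s + 1)   ≡⟨ cong (z +_) (+-comm s 1) ⟩
  z + (1 + s)   ≡⟨ +-assoc z 1 s ⟨
  z + 1 + s     ∎
  where open ≡-Reasoning

up-down-up : parity x ≡ 0ℙ → Step 1 x y → Step s y z → Step 1 z w →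
  parity s ≡ 1ℙ × parity z ≡ 0ℙ × x + 2 ≡ w + s × (s ≡ 1 → x ≡ z × y ≡ w)
up-down-up {x} {y} {s} {z} {w} even-x s₁ s₂ s₃
  with y≡x+1 ← Step-up refl even-x s₁
     | odd-y ← Step-flips-parity refl s₁ even-x
  with odd-s , z+s≡y ← Step-down odd-y s₂
  with even-z ← Step-flips-parity odd-s s₂ odd-y
  with w≡z+1 ← Step-up refl even-z s₃
  = odd-s , even-z , up-down-up-gap y≡x+1 z+s≡y w≡z+1 , unit-size
  where
  unit-size : s ≡ 1 → x ≡ z × y ≡ w
  unit-size refl = +-cancelʳ-≡ 1 x z (sym (trans z+s≡y y≡x+1))
                 , trans (sym z+s≡y) (sym w≡z+1)

zigzag₁-even-impossible : parity t₁ ≡ 0ℙ → β ∣ t₁ → γ ∣ t₆ → t₁ ≢ t₃ → t₄ ≢ t₆ →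
  Step 1 t₁ t₂ → Step γ t₂ t₃ → Step 1 t₃ t₄ → Step β t₄ t₅ → Step 1 t₅ t₆ → ⊥
zigzag₁-even-impossible even β∣t₁ γ∣t₆ t₁≢t₃ t₄≢t₆ s₁ s₂ s₃ s₄ s₅
  with odd-γ , even-t₃ , gap₁ , γ≡1⇒ ← up-down-up even s₁ s₂ s₃
  with odd-β , _ , gap₂ , β≡1⇒ ← up-down-up even-t₃ s₃ s₄ s₅
  = <-asym (multiple-gap⇒< β∣t₁ (Step-∣ˡ s₄) gap₁ (odd≢1⇒3≤ odd-γ (t₁≢t₃ ∘ proj₁ ∘ γ≡1⇒)))
           (multiple-gap⇒< (Step-∣ʳ s₂) γ∣t₆ gap₂ (odd≢1⇒3≤ odd-β (t₄≢t₆ ∘ proj₂ ∘ β≡1⇒)))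

zigzag₁-flips-parity : parity β ≡ 1ℙ → parity γ ≡ 1ℙ →
  Step 1 t₁ t₂ → Step γ t₂ t₃ → Step 1 t₃ t₄ → Step β t₄ t₅ → Step 1 t₅ t₆ →
  ∀ {p} → parity t₁ ≡ p → parity t₆ ≡ p ⁻¹ ⁻¹ ⁻¹ ⁻¹ ⁻¹
zigzag₁-flips-parity odd-β odd-γ s₁ s₂ s₃ s₄ s₅ =
  Step-flips-parity refl s₅ ∘ Step-flips-parity odd-β s₄ ∘ Step-flips-parity refl s₃
  ∘ Step-flips-parity odd-γ s₂ ∘ Step-flips-parity refl s₁

zigzag₁-impossible : ∀ {β γ t₁ t₂ t₃ t₄ t₅ t₆} → β ∣ t₁ → γ ∣ t₆ → t₁ ≢ t₃ → t₄ ≢ t₆ →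
  Step 1 t₁ t₂ → Step γ t₂ t₃ → Step 1 t₃ t₄ → Step β t₄ t₅ → Step 1 t₅ t₆ → ⊥
zigzag₁-impossible {t₁ = t₁} {t₆ = t₆} β∣t₁ γ∣t₆ t₁≢t₃ t₄≢t₆ s₁ s₂ s₃ s₄ s₅
  with parity t₁ in p₁ | parity t₆ in p₆
... | 0ℙ | _ = zigzag₁-even-impossible p₁ β∣t₁ γ∣t₆ t₁≢t₃ t₄≢t₆ s₁ s₂ s₃ s₄ s₅
... | _ | 0ℙ = zigzag₁-even-impossible p₆ γ∣t₆ β∣t₁ (t₄≢t₆ ∘ sym) (t₁≢t₃ ∘ sym)
                 (Step-sym s₅) (Step-sym s₄) (Step-sym s₃) (Step-sym s₂) (Step-sym s₁)
... | 1ℙ | 1ℙ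
  with () ← trans (sym p₆) (zigzag₁-flips-parity (odd-divisor β∣t₁ p₁) (odd-divisor γ∣t₆ p₆)
                                                 s₁ s₂ s₃ s₄ s₅ p₁)

zigzag-impossible : .{{_ : NonZero a}} → b ∣ T₁ → c ∣ T₆ → T₁ ≢ T₃ → T₄ ≢ T₆ →
  Step a T₁ T₂ → Step c T₂ T₃ → Step a T₃ T₄ → Step b T₄ T₅ → Step a T₅ T₆ → ⊥
zigzag-impossible {a} b∣T₁ c∣T₆ T₁≢T₃ T₄≢T₆ s₁ s₂ s₃ s₄ s₅
  with divides t₁ refl ← Step-∣ˡ s₁ | divides t₂ refl ← Step-∣ʳ s₁
     | divides t₃ refl ← Step-∣ˡ s₃ | divides t₄ refl ← Step-∣ʳ s₃
     | divides t₅ refl ← Step-∣ˡ s₅ | divides t₆ refl ← Step-∣ʳ s₅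
  with divides γ refl ← Step-size-∣ (n∣m*n t₂) (n∣m*n t₃) s₂
     | divides β refl ← Step-size-∣ (n∣m*n t₄) (n∣m*n t₅) s₄
  = zigzag₁-impossible {β} {γ} {t₁} {t₂} {t₃} {t₄} {t₅} {t₆}
      (*-cancelʳ-∣ a b∣T₁) (*-cancelʳ-∣ a c∣T₆)
      (T₁≢T₃ ∘ cong (_* a)) (T₄≢T₆ ∘ cong (_* a))
      (Step-cancel-unit s₁) (Step-cancel s₂) (Step-cancel-unit s₃)
      (Step-cancel s₄) (Step-cancel-unit s₅)

claim15 : (a b c : ℕ) → 0 < a → 0 < b → 0 < c →
    Forbidden (b ∷ a ∷ c ∷ a ∷ b ∷ a ∷ c ∷ [])
claim15 a b c 0<a _ _
  ( _ , step s₀ (step s₁ (step s₂ (step s₃ (step s₄ (step s₅ (step s₆ (done _)))))))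
  , _ ∷ (_ ∷ T₁≢T₃ ∷ _) ∷ _ ∷ _ ∷ (_ ∷ T₄≢T₆ ∷ _) ∷ _ ) =
  zigzag-impossible {{>-nonZero 0<a}} (Step-∣ʳ s₀) (Step-∣ˡ s₆) T₁≢T₃ T₄≢T₆ s₁ s₂ s₃ s₄ s₅
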